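{- For every integer $q>3$ prime to $3$, $$N(3,q)=N(3,q-3)+\Big\lfloor\frac q2\Big\rfloor+1,$$ and for every integer $q\ge4$ prime to $3$, $$\mathrm{Sym}(3,q)=\mathrm{Sym}(3,q-3)+\begin{cases}2 & q\text{ even},\\1 & q\text{ odd},\end{cases}\qquad \mathrm{Psym}(3,q)=\mathrm{Psym}(3,q-3)+\begin{cases}1 & q\text{ even},\\2 & q\text{ odd}.\end{cases}$$
   Context: A numerical semigroup is an additive submonoid $H\subseteq\mathbb N=\{0,1,\dots\}$ with finite complement; $g(H)=|\mathbb N\setminus H|$ and $F(H)$ is the largest integer not in $H$. $H$ is symmetric if $2g(H)=F(H)+1$ and pseudo-symmetric if $2g(H)=F(H)+2$. For $q$ prime to $p$, $N(p,q)$, $\mathrm{Sym}(p,q)$, $\mathrm{Psym}(p,q)$ denote the numbers of numerical semigroups containing both $p$ and $q$ that are arbitrary, symmetric, pseudo-symmetric, respectively. -}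

module Defs where

open import Data.Bool using (Bool; true; false; if_then_else_)
open import Data.Bool.Properties using () renaming (_≟_ to _≟ᵇ_)
open import Data.Nat using (ℕ; zero; suc; _+_; _*_)
open import Data.Nat.Properties using () renaming (_≟_ to _≟ⁿ_)
open import Data.Fin using (Fin; toℕ)
open import Data.Fin.Properties using (all?)
open import Data.Vec using (Vec; []; _∷_)
open import Data.List using (List; []; _∷_; map; _++_; length; filter)
open import Data.Product using (_×_)
open import Relation.Binary.PropositionalEquality using (_≡_)
open import Relation.Nullary using (Dec; does)
open import Relation.Nullary.Decidable using (_×-dec_; _→-dec_)

-- Encoding of a numerical semigroup H with [B, ∞) ⊆ H by a bit-vector
-- v : Vec Bool B :  n ∈ H  iff  mem v n ≡ true  (every n ≥ B is in H).
mem : ∀ {B} → Vec Bool B → ℕ → Bool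
mem []      n       = true
mem (b ∷ v) zero    = b
mem (b ∷ v) (suc n) = mem v n

-- H (encoded by v) is a numerical semigroup: 0 ∈ H and H is closed under +.
-- (Finite complement is automatic.)  Closure only needs checking for
-- a, b < B, since a ≥ B or b ≥ B gives a + b ≥ B, which lies in H.
IsNumSemigroup : ∀ {B} → Vec Bool B → Set
IsNumSemigroup {B} v =
  (mem v 0 ≡ true) ×
  ((i j : Fin B) → mem v (toℕ i) ≡ true → mem v (toℕ j) ≡ true →
     mem v (toℕ i + toℕ j) ≡ true)

IsNSContaining : ℕ → ℕ → ∀ {B} → Vec Bool B → Set
IsNSContaining p q v = IsNumSemigroup v × (mem v p ≡ true) × (mem v q ≡ true)

isNSContaining? : ∀ p q {B} (v : Vec Bool B) → Dec (IsNSContaining p q v)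
isNSContaining? p q v =
  (mem v 0 ≟ᵇ true ×-dec
    all? (λ i → all? (λ j →
      (mem v (toℕ i) ≟ᵇ true) →-dec ((mem v (toℕ j) ≟ᵇ true) →-dec
        (mem v (toℕ i + toℕ j) ≟ᵇ true)))))
  ×-dec (mem v p ≟ᵇ true) ×-dec (mem v q ≟ᵇ true)

genus : ∀ {B} → Vec Bool B → ℕ
genus []          = 0
genus (true ∷ v)  = genus v
genus (false ∷ v) = suc (genus v)

-- frob1 v = F(H) + 1, where F(H) is the largest gap (F(ℕ) = -1, so frob1 = 0).
frob1 : ∀ {B} → Vec Bool B → ℕ
frob1 []      = 0
frob1 (b ∷ v) with frob1 v
... | zero  = if b then 0 else 1
... | suc k = suc (suc k)

IsSymmetric : ∀ {B} → Vec Bool B → Set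
IsSymmetric v = 2 * genus v ≡ frob1 v

IsPseudoSymmetric : ∀ {B} → Vec Bool B → Set
IsPseudoSymmetric v = 2 * genus v ≡ suc (frob1 v)

allVecs : (B : ℕ) → List (Vec Bool B)
allVecs zero    = [] ∷ []
allVecs (suc B) = map (true ∷_) (allVecs B) ++ map (false ∷_) (allVecs B)

-- Every numerical semigroup containing coprime p, q contains all n ≥ (p-1)(q-1),
-- hence all n ≥ p * q; so such semigroups correspond bijectively to the
-- vectors v : Vec Bool (p * q) satisfying IsNSContaining p q v.
N : ℕ → ℕ → ℕ
N p q = length (filter (isNSContaining? p q) (allVecs (p * q)))

Sym : ℕ → ℕ → ℕ
Sym p q = length (filter (λ v → isNSContaining? p q v ×-dec (2 * genus v ≟ⁿ frob1 v))
                         (allVecs (p * q)))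

Psym : ℕ → ℕ → ℕ
Psym p q = length (filter (λ v → isNSContaining? p q v ×-dec (2 * genus v ≟ⁿ suc (frob1 v)))
                          (allVecs (p * q)))

-- A numerical semigroup H containing 3 is determined by its Apéry set {0, 3a+1, 3b+2} with
-- respect to 3, and the admissible pairs (a, b) are the lattice points of the Kunz polygon
-- b ≤ 2a, a ≤ 2b+1. In these coordinates g(H) = a + b and F(H) + 1 = max(3a − 1, 3b), so H is
-- symmetric iff one Apéry element is twice the other, and pseudo-symmetric iff one is twice
-- the other minus 3. For q = 3T + r prime to 3, H contains q but not q − 3 exactly when its
-- Apéry element in the class of q is q itself, i.e. a = T (r = 1) or b = T (r = 2). Passing
-- from q − 3 to q therefore adds one row of the polygon, and counting its points, and its
-- symmetric and pseudo-symmetric points, according to the parity of T gives the increments.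

module Submission where

open import Defs
open import Data.Bool using (Bool; true; false; if_then_else_)
open import Data.Bool.Properties using () renaming (_≟_ to _≟ᵇ_)
open import Data.Empty using (⊥)
open import Data.Fin using (Fin; toℕ; fromℕ<)
open import Data.Fin.Properties using (toℕ-fromℕ<)
open import Data.List using (List; []; _∷_; map; filter; length; upTo; applyUpTo; cartesianProduct)
open import Data.List.Properties using (map-∘; map-id-local; length-map; length-applyUpTo; filter-≐)
open import Data.List.Membership.Propositional using (_∈_)
open import Data.List.Membership.Propositional.Properties
  using ( ∈-map⁺; ∈-map⁻; ∈-++⁺ˡ; ∈-++⁺ʳ; ∈-filter⁺; ∈-filter⁻; ∈-applyUpTo⁺; ∈-applyUpTo⁻
        ; ∈-upTo⁺; ∈-cartesianProduct⁺)
open import Data.List.Membership.Propositional.Properties.WithK using (unique∧set⇒bag)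
open import Data.List.Relation.Unary.All as All using (All)
open import Data.List.Relation.Unary.AllPairs using ([]; _∷_)
open import Data.List.Relation.Unary.Any using (here; there)
open import Data.List.Relation.Unary.Unique.Propositional using (Unique)
import Data.List.Relation.Unary.Unique.Propositional.Properties as Unique
open import Data.List.Relation.Binary.BagAndSetEquality using (_∼[_]_; set; ∼bag⇒↭)
open import Data.List.Relation.Binary.Permutation.Propositional.Properties using (↭-length)
open import Data.Nat
  using (ℕ; zero; suc; pred; _+_; _*_; _∸_; _<_; _≤_; _/_; _%_; _≡ᵇ_; z≤n; s≤s; s≤s⁻¹; _≤?_; _<?_)
open import Data.Nat.Properties
open import Data.Nat.Coprimality using (Coprime)
open import Data.Nat.Divisibility using (_∣_; n∣m*n; ∣m+n∣m⇒∣n; ∣⇒≤; ∣-refl)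
open import Data.Nat.DivMod using (m*n/n≡m; m*n%n≡0; [m+kn]%n≡m%n; +-distrib-/-∣ʳ)
open import Data.Nat.Tactic.RingSolver using (solve-∀)
open import Data.Product as Product using (_×_; _,_; proj₁; proj₂; ∃; uncurry)
open import Data.Product.Function.NonDependent.Propositional using (_×-⇔_)
open import Data.Sum using (_⊎_; inj₁; inj₂)
open import Data.Vec using (Vec; []; _∷_)
open import Data.Vec.Properties using (∷-injectiveʳ)
open import Function using (_∘_; _⇔_; mk⇔; Equivalence)
open import Function.Construct.Composition using (_⇔-∘_)
open import Level using (0ℓ)
open import Relation.Nullary using (¬_; yes; no; contradiction)
open import Relation.Nullary.Decidable using (_×-dec_; _⊎-dec_)
open import Relation.Unary using (Pred; Decidable; ∁; _∩_; _≐_)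
open import Relation.Unary.Properties using (_∩?_; ∁?)
open import Relation.Binary.PropositionalEquality
  using (_≡_; _≢_; refl; sym; trans; cong; cong₂; subst; subst₂; module ≡-Reasoning)

module _ {a} {A : Set a} where

  unique₁ : ∀ {x : A} → Unique (x ∷ [])
  unique₁ = All.[] ∷ []

  unique₂ : ∀ {x y : A} → x ≢ y → Unique (x ∷ y ∷ [])
  unique₂ x≢y = (x≢y All.∷ All.[]) ∷ All.[] ∷ []

  length-∼set : {xs ys : List A} → Unique xs → Unique ys → xs ∼[ set ] ys → length xs ≡ length ys
  length-∼set xs! ys! xs≈ys = ↭-length (∼bag⇒↭ (unique∧set⇒bag xs! ys! xs≈ys))

  Unique-map⁺-retraction : ∀ {b} {B : Set b} {f : A → B} (g : B → A) {xs : List A} →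
                           All (λ x → g (f x) ≡ x) xs → Unique xs → Unique (map f xs)
  Unique-map⁺-retraction {f = f} g {xs} gf≗id xs! =
    Unique.map⁻ {f = g} (subst Unique (sym (trans (sym (map-∘ xs)) (map-id-local gf≗id))) xs!)

  length-filter-split : ∀ {p q} {P : Pred A p} {Q : Pred A q} (P? : Decidable P) (Q? : Decidable Q) xs →
    length (filter P? xs) ≡ length (filter (P? ∩? Q?) xs) + length (filter (P? ∩? ∁? Q?) xs)
  length-filter-split P? Q? [] = refl
  length-filter-split P? Q? (x ∷ xs) with P? x | Q? x
  ... | yes _ | yes _ = cong suc (length-filter-split P? Q? xs)
  ... | yes _ | no _  = trans (cong suc (length-filter-split P? Q? xs)) (sym (+-suc _ _))
  ... | no _  | _     = length-filter-split P? Q? xs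

∈-allVecs : ∀ {B} (v : Vec Bool B) → v ∈ allVecs B
∈-allVecs []                  = here refl
∈-allVecs {suc B} (true ∷ v)  = ∈-++⁺ˡ (∈-map⁺ (true ∷_) (∈-allVecs v))
∈-allVecs {suc B} (false ∷ v) = ∈-++⁺ʳ (map (true ∷_) (allVecs B)) (∈-map⁺ (false ∷_) (∈-allVecs v))

allVecs-unique : ∀ B → Unique (allVecs B)
allVecs-unique zero    = unique₁
allVecs-unique (suc B) =
  Unique.++⁺ (Unique.map⁺ ∷-injectiveʳ (allVecs-unique B)) (Unique.map⁺ ∷-injectiveʳ (allVecs-unique B))
             disjoint
  where
  disjoint : ∀ {v} → v ∈ map (true ∷_) (allVecs B) × v ∈ map (false ∷_) (allVecs B) → ⊥
  disjoint (v∈true∷ , v∈false∷) with ∈-map⁻ (true ∷_) v∈true∷ | ∈-map⁻ (false ∷_) v∈false∷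
  ... | _ , _ , refl | _ , _ , ()

box : ℕ → List (ℕ × ℕ)
box K = cartesianProduct (upTo K) (upTo K)

box-unique : ∀ K → Unique (box K)
box-unique K = Unique.cartesianProduct⁺ (Unique.upTo⁺ K) (Unique.upTo⁺ K)

∈-box : ∀ {K a b} → a < K → b < K → (a , b) ∈ box K
∈-box a<K b<K = ∈-cartesianProduct⁺ (∈-upTo⁺ a<K) (∈-upTo⁺ b<K)

range : ℕ → ℕ → List ℕ
range lo len = applyUpTo (lo +_) len

range-unique : ∀ lo len → Unique (range lo len)
range-unique lo len = Unique.applyUpTo⁺₁ (lo +_) len (λ i<j _ → <⇒≢ (+-monoʳ-< lo i<j))

length-range : ∀ lo len → length (range lo len) ≡ len
length-range lo = length-applyUpTo (lo +_)

∈-range⇔ : ∀ {lo len c} → (lo ≤ c × c < lo + len) ⇔ c ∈ range lo len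
∈-range⇔ {lo} {len} {c} = mk⇔
  (λ (lo≤c , c<lo+len) → subst (_∈ range lo len) (m+[n∸m]≡n lo≤c)
     (∈-applyUpTo⁺ (lo +_) (subst (c ∸ lo <_) (m+n∸m≡n lo len) (∸-monoˡ-< c<lo+len lo≤c))))
  (λ c∈ → let (i , i<len , c≡lo+i) = ∈-applyUpTo⁻ (lo +_) c∈ in
     subst (λ c → lo ≤ c × c < lo + len) (sym c≡lo+i) (m≤m+n lo i , +-monoʳ-< lo i<len))

data Mod3 : ℕ → Set where
  0mod3 : ∀ t → Mod3 (t * 3)
  1mod3 : ∀ t → Mod3 (t * 3 + 1)
  2mod3 : ∀ t → Mod3 (t * 3 + 2)

mod3 : ∀ n → Mod3 n
mod3 0 = 0mod3 0
mod3 1 = 1mod3 0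
mod3 2 = 2mod3 0
mod3 (suc (suc (suc n))) with mod3 n
... | 0mod3 t = 0mod3 (suc t)
... | 1mod3 t = 1mod3 (suc t)
... | 2mod3 t = 2mod3 (suc t)

3∤3t+1 : ∀ t → ¬ 3 ∣ t * 3 + 1
3∤3t+1 t 3∣q with ∣⇒≤ (∣m+n∣m⇒∣n 3∣q (n∣m*n t))
... | s≤s ()

3∤3t+2 : ∀ t → ¬ 3 ∣ t * 3 + 2
3∤3t+2 t 3∣q with ∣⇒≤ (∣m+n∣m⇒∣n 3∣q (n∣m*n t))
... | s≤s (s≤s ())

data ParityView : ℕ → Set where
  even : ∀ m → ParityView (2 * m)
  odd  : ∀ m → ParityView (suc (2 * m))

parityView : ∀ n → ParityView n
parityView zero = even 0
parityView (suc n) with parityView n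
... | even m = odd m
... | odd m  = subst ParityView (*-suc 2 m) (even (suc m))

≤-by : ∀ {x y} d → y ≡ x + d → x ≤ y
≤-by {x} d refl = m≤m+n x d

<-by : ∀ {x y} d → y ≡ suc (x + d) → x < y
<-by {x} d refl = s≤s (m≤m+n x d)

n≤2*n : ∀ n → n ≤ 2 * n
n≤2*n n = m≤m+n n (n + 0)

n<2*n : ∀ {n} → 0 < n → n < 2 * n
n<2*n {suc n} _ = s≤s (m<m+n n (s≤s z≤n))

2*-≤-+ : ∀ {a s u} → a ≤ s → a ≤ u → 2 * a ≤ s + u
2*-≤-+ {a} {s} {u} a≤s a≤u = subst (_≤ s + u) (cong (a +_) (sym (+-identityʳ a))) (+-mono-≤ a≤s a≤u)

≤⇔< : ∀ {c x y} → y ≡ suc x → (c ≤ x) ⇔ (c < y)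
≤⇔< refl = mk⇔ s≤s s≤s⁻¹

2m≤1+2n⇔ : ∀ {m n} → 2 * m ≤ suc (2 * n) ⇔ m ≤ n
2m≤1+2n⇔ {m} {n} = mk⇔
  (λ 2m≤1+2n → s≤s⁻¹ (*-cancelˡ-< 2 m (suc n) (subst (2 * m <_) (sym (*-suc 2 n)) (s≤s 2m≤1+2n))))
  (λ m≤n → ≤-trans (*-monoʳ-≤ 2 m≤n) (n≤1+n _))

1+2m≤1+2n⇔ : ∀ {m n} → suc (2 * m) ≤ suc (2 * n) ⇔ m ≤ n
1+2m≤1+2n⇔ = mk⇔ (*-cancelˡ-≤ 2 ∘ s≤s⁻¹) (s≤s ∘ *-monoʳ-≤ 2)

2m≤2n⇔ : ∀ {m n} → 2 * m ≤ 2 * n ⇔ m ≤ n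
2m≤2n⇔ = mk⇔ (*-cancelˡ-≤ 2) (*-monoʳ-≤ 2)

1+2m≤2n⇔ : ∀ {m n} → suc (2 * m) ≤ 2 * n ⇔ suc m ≤ n
1+2m≤2n⇔ {m} {n} = mk⇔
  (*-cancelˡ-< 2 m n)
  (λ m<n → ≤-trans (subst (suc (2 * m) ≤_) (sym (*-suc 2 m)) (n≤1+n _)) (*-monoʳ-≤ 2 m<n))

2[a+b]≡d+3b⇔ : ∀ a b d → 2 * (a + b) ≡ d + b * 3 ⇔ 2 * a ≡ d + b
2[a+b]≡d+3b⇔ a b d = mk⇔
  (λ e → +-cancelʳ-≡ (2 * b) (2 * a) (d + b) (trans (sym (lhs a b)) (trans e (rhs d b))))
  (λ e → trans (lhs a b) (trans (cong (_+ 2 * b) e) (sym (rhs d b))))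
  where
  lhs : ∀ a b → 2 * (a + b) ≡ 2 * a + 2 * b
  lhs = solve-∀
  rhs : ∀ d b → d + b * 3 ≡ d + b + 2 * b
  rhs = solve-∀

2[1+a+b]≡d+3a+2⇔ : ∀ a b d → 2 * (suc a + b) ≡ d + suc (suc (a * 3)) ⇔ 2 * b ≡ d + a
2[1+a+b]≡d+3a+2⇔ a b d = mk⇔
  (λ e → Equivalence.to (2[a+b]≡d+3b⇔ b a d)
           (suc-injective (suc-injective (trans (sym (lhs a b)) (trans e (rhs d a))))))
  (λ e → trans (lhs a b) (trans (cong (suc ∘ suc) (Equivalence.from (2[a+b]≡d+3b⇔ b a d) e)) (sym (rhs d a))))
  where
  lhs : ∀ a b → 2 * (suc a + b) ≡ suc (suc (2 * (b + a)))
  lhs = solve-∀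
  rhs : ∀ d a → d + suc (suc (a * 3)) ≡ suc (suc (d + a * 3))
  rhs = solve-∀

-- Kunz coordinates

-- memK a b is the membership test of the set with Apéry set {0, 3a+1, 3b+2} with respect to 3.
memK : ℕ → ℕ → ℕ → Bool
memK a b 0 = true
memK a b 1 = a ≡ᵇ 0
memK a b 2 = b ≡ᵇ 0
memK a b (suc (suc (suc i))) = memK (pred a) (pred b) i

Contains : ℕ → Pred (ℕ × ℕ) 0ℓ
Contains q (a , b) = memK a b q ≡ true

contains? : ∀ q → Decidable (Contains q)
contains? q (a , b) = memK a b q ≟ᵇ true

-- 2(3a+1) ≥ 3b+2 and 2(3b+2) ≥ 3a+1: exactly what makes memK a b closed under addition.
Kunz : Pred (ℕ × ℕ) 0ℓ
Kunz (a , b) = b ≤ 2 * a × a ≤ suc (2 * b)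

kunz? : Decidable Kunz
kunz? (a , b) = (b ≤? 2 * a) ×-dec (a ≤? suc (2 * b))

memK-0 : ∀ a b t → memK a b (t * 3) ≡ true
memK-0 a b zero    = refl
memK-0 a b (suc t) = memK-0 (pred a) (pred b) t

memK-1⁺ : ∀ {a t} b → a ≤ t → memK a b (t * 3 + 1) ≡ true
memK-1⁺ {t = zero}  b z≤n = refl
memK-1⁺ {t = suc t} b a≤t = memK-1⁺ {t = t} (pred b) (pred-mono-≤ a≤t)

memK-1⁻ : ∀ a b t → memK a b (t * 3 + 1) ≡ true → a ≤ t
memK-1⁻ zero    b t       _  = z≤n
memK-1⁻ (suc a) b (suc t) eq = s≤s (memK-1⁻ a (pred b) t eq)

memK-2⁺ : ∀ {b t} a → b ≤ t → memK a b (t * 3 + 2) ≡ true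
memK-2⁺ {t = zero}  a z≤n = refl
memK-2⁺ {t = suc t} a b≤t = memK-2⁺ {t = t} (pred a) (pred-mono-≤ b≤t)

memK-2⁻ : ∀ a b t → memK a b (t * 3 + 2) ≡ true → b ≤ t
memK-2⁻ a zero    t       _  = z≤n
memK-2⁻ a (suc b) (suc t) eq = s≤s (memK-2⁻ (pred a) b t eq)

memK-+3 : ∀ a b i → memK a b i ≡ true → memK a b (3 + i) ≡ true
memK-+3 a b i i∈ with mod3 i
... | 0mod3 t = memK-0 (pred a) (pred b) t
... | 1mod3 t = memK-1⁺ (pred b) (≤-trans pred[n]≤n (memK-1⁻ a b t i∈))
... | 2mod3 t = memK-2⁺ (pred a) (≤-trans pred[n]≤n (memK-2⁻ a b t i∈))

memK-shift : ∀ a b t {i} → memK a b i ≡ true → memK a b (t * 3 + i) ≡ true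
memK-shift a b zero        i∈ = i∈
memK-shift a b (suc t) {i} i∈ = memK-+3 a b (t * 3 + i) (memK-shift a b t i∈)

memK-+ : ∀ {a b} → Kunz (a , b) →
         ∀ i j → memK a b i ≡ true → memK a b j ≡ true → memK a b (i + j) ≡ true
memK-+ {a} {b} (b≤2a , a≤1+2b) i j i∈ j∈ with mod3 i | mod3 j
... | 0mod3 s | _       = memK-shift a b s j∈
... | _       | 0mod3 u = subst (λ k → memK a b k ≡ true) (+-comm (u * 3) i) (memK-shift a b u i∈)
... | 1mod3 s | 1mod3 u = subst (λ k → memK a b k ≡ true) (e s u)
        (memK-2⁺ a (≤-trans b≤2a (2*-≤-+ (memK-1⁻ a b s i∈) (memK-1⁻ a b u j∈))))
  where e : ∀ s u → (s + u) * 3 + 2 ≡ (s * 3 + 1) + (u * 3 + 1)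
        e = solve-∀
... | 1mod3 s | 2mod3 u = subst (λ k → memK a b k ≡ true) (e s u) (memK-0 a b (suc (s + u)))
  where e : ∀ s u → suc (s + u) * 3 ≡ (s * 3 + 1) + (u * 3 + 2)
        e = solve-∀
... | 2mod3 s | 1mod3 u = subst (λ k → memK a b k ≡ true) (e s u) (memK-0 a b (suc (s + u)))
  where e : ∀ s u → suc (s + u) * 3 ≡ (s * 3 + 2) + (u * 3 + 1)
        e = solve-∀
... | 2mod3 s | 2mod3 u = subst (λ k → memK a b k ≡ true) (e s u)
        (memK-1⁺ b (≤-trans a≤1+2b (s≤s (2*-≤-+ (memK-2⁻ a b s i∈) (memK-2⁻ a b u j∈)))))
  where e : ∀ s u → suc (s + u) * 3 + 1 ≡ (s * 3 + 2) + (u * 3 + 2)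
        e = solve-∀

kunz-bounded : ∀ {q a b} → ¬ 3 ∣ q → Kunz (a , b) → Contains q (a , b) → a ≤ q × b ≤ q
kunz-bounded {q} {a} {b} 3∤q (b≤2a , a≤1+2b) q∈ with mod3 q
... | 0mod3 t = contradiction (n∣m*n t) 3∤q
... | 1mod3 t = ≤-trans a≤t (≤-trans (n≤2*n t) 2t≤q) ,
                ≤-trans b≤2a (≤-trans (*-monoʳ-≤ 2 a≤t) 2t≤q)
  where
  a≤t = memK-1⁻ a b t q∈
  2t≤q : 2 * t ≤ t * 3 + 1
  2t≤q = ≤-by (suc t) (e t)
    where e : ∀ t → t * 3 + 1 ≡ 2 * t + suc t
          e = solve-∀
... | 2mod3 t = ≤-trans a≤1+2b (≤-trans (s≤s (*-monoʳ-≤ 2 b≤t)) 1+2t≤q) ,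
                ≤-trans b≤t (≤-trans (n≤2*n t) (≤-trans (n≤1+n _) 1+2t≤q))
  where
  b≤t = memK-2⁻ a b t q∈
  1+2t≤q : suc (2 * t) ≤ t * 3 + 2
  1+2t≤q = ≤-by (suc t) (e t)
    where e : ∀ t → t * 3 + 2 ≡ suc (2 * t) + suc t
          e = solve-∀

vecK : (n : ℕ) → ℕ → ℕ → Vec Bool (n * 3)
vecK zero    a b = []
vecK (suc n) a b = true ∷ (a ≡ᵇ 0) ∷ (b ≡ᵇ 0) ∷ vecK n (pred a) (pred b)

memK-0-0 : ∀ i → memK 0 0 i ≡ true
memK-0-0 0 = refl
memK-0-0 1 = refl
memK-0-0 2 = refl
memK-0-0 (suc (suc (suc i))) = memK-0-0 i

mem-vecK : ∀ {n a b} → a ≤ n → b ≤ n → ∀ i → mem (vecK n a b) i ≡ memK a b i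
mem-vecK {zero}  z≤n z≤n i = sym (memK-0-0 i)
mem-vecK {suc n} a≤n b≤n 0 = refl
mem-vecK {suc n} a≤n b≤n 1 = refl
mem-vecK {suc n} a≤n b≤n 2 = refl
mem-vecK {suc n} a≤n b≤n (suc (suc (suc i))) = mem-vecK (pred-mono-≤ a≤n) (pred-mono-≤ b≤n) i

genus-vecK : ∀ {n a b} → a ≤ n → b ≤ n → genus (vecK n a b) ≡ a + b
genus-vecK {zero}  z≤n z≤n = refl
genus-vecK {suc n} {zero}  {zero}  _         _         = genus-vecK {n} z≤n z≤n
genus-vecK {suc n} {suc a} {zero}  (s≤s a≤n) _         = cong suc (genus-vecK a≤n z≤n)
genus-vecK {suc n} {zero}  {suc b} _         (s≤s b≤n) = cong suc (genus-vecK z≤n b≤n)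
genus-vecK {suc n} {suc a} {suc b} (s≤s a≤n) (s≤s b≤n) =
  trans (cong (suc ∘ suc) (genus-vecK a≤n b≤n)) (cong suc (sym (+-suc a b)))

frob1-false∷ : ∀ {B} (v : Vec Bool B) → frob1 (false ∷ v) ≡ suc (frob1 v)
frob1-false∷ v with frob1 v
... | zero  = refl
... | suc _ = refl

frob1-true∷ : ∀ {B} (v : Vec Bool B) → frob1 v ≡ 0 → frob1 (true ∷ v) ≡ 0
frob1-true∷ v eq with frob1 v
... | zero = refl

frob1-∷-suc : ∀ {B} x (v : Vec Bool B) {k} → frob1 v ≡ suc k → frob1 (x ∷ v) ≡ suc (suc k)
frob1-∷-suc x v eq with frob1 v
... | suc _ = cong suc eq

frob1-vecK-0-0 : ∀ n → frob1 (vecK n 0 0) ≡ 0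
frob1-vecK-0-0 zero    = refl
frob1-vecK-0-0 (suc n) =
  frob1-true∷ (true ∷ true ∷ rest) (frob1-true∷ (true ∷ rest) (frob1-true∷ rest (frob1-vecK-0-0 n)))
  where rest = vecK n 0 0

frob1-vecK-≤ : ∀ {n a b} → a ≤ b → b ≤ n → frob1 (vecK n a b) ≡ b * 3
frob1-vecK-≤ {n} z≤n z≤n = frob1-vecK-0-0 n
frob1-vecK-≤ {suc n} {a} {suc b} a≤b (s≤s b≤n) =
  frob1-∷-suc true ((a ≡ᵇ 0) ∷ false ∷ rest) (frob1-∷-suc (a ≡ᵇ 0) (false ∷ rest)
    (trans (frob1-false∷ rest) (cong suc (frob1-vecK-≤ (pred-mono-≤ a≤b) b≤n))))
  where rest = vecK n (pred a) b

frob1-vecK-> : ∀ {n a b} → b ≤ a → suc a ≤ n → frob1 (vecK n (suc a) b) ≡ suc (suc (a * 3))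
frob1-vecK-> {suc n} {zero} z≤n _ =
  frob1-∷-suc true (false ∷ true ∷ rest)
    (trans (frob1-false∷ (true ∷ rest)) (cong suc (frob1-true∷ rest (frob1-vecK-0-0 n))))
  where rest = vecK n 0 0
frob1-vecK-> {suc n} {suc a} {b} b≤a (s≤s a<n) =
  frob1-∷-suc true (false ∷ (b ≡ᵇ 0) ∷ rest) (frob1-∷-suc false ((b ≡ᵇ 0) ∷ rest)
    (frob1-∷-suc (b ≡ᵇ 0) rest (frob1-vecK-> (pred-mono-≤ b≤a) a<n)))
  where rest = vecK n (suc a) (pred b)

mem-≥ : ∀ {B} (v : Vec Bool B) {i} → B ≤ i → mem v i ≡ true
mem-≥ []      _         = refl
mem-≥ (_ ∷ v) (s≤s B≤i) = mem-≥ v B≤i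

isNS-+ : ∀ {B} {v : Vec Bool B} → IsNumSemigroup v →
         ∀ i j → mem v i ≡ true → mem v j ≡ true → mem v (i + j) ≡ true
isNS-+ {B} {v} (_ , closed) i j i∈ j∈ with i <? B | j <? B
... | yes i<B | yes j<B =
  subst₂ (λ i j → mem v (i + j) ≡ true) (toℕ-fromℕ< i<B) (toℕ-fromℕ< j<B)
    (closed (fromℕ< i<B) (fromℕ< j<B) (via-fromℕ< i<B i∈) (via-fromℕ< j<B j∈))
  where
  via-fromℕ< : ∀ {k} (k<B : k < B) → mem v k ≡ true → mem v (toℕ (fromℕ< k<B)) ≡ true
  via-fromℕ< k<B = subst (λ k → mem v k ≡ true) (sym (toℕ-fromℕ< k<B))
... | no i≮B | _      = mem-≥ v (≤-trans (≮⇒≥ i≮B) (m≤m+n i j))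
... | yes _  | no j≮B = mem-≥ v (≤-trans (≮⇒≥ j≮B) (m≤n+m j i))

vecK-isNS : ∀ {n a b q} → a ≤ n → b ≤ n → Kunz (a , b) → Contains q (a , b) →
            IsNSContaining 3 q (vecK n a b)
vecK-isNS {n} {a} {b} {q} a≤n b≤n kunz q∈ = (∈vecK 0 refl , closed) , ∈vecK 3 refl , ∈vecK q q∈
  where
  ∈vecK : ∀ i → memK a b i ≡ true → mem (vecK n a b) i ≡ true
  ∈vecK i = trans (mem-vecK a≤n b≤n i)
  ∈memK : ∀ i → mem (vecK n a b) i ≡ true → memK a b i ≡ true
  ∈memK i = trans (sym (mem-vecK a≤n b≤n i))
  closed : (i j : Fin (n * 3)) → mem (vecK n a b) (toℕ i) ≡ true → mem (vecK n a b) (toℕ j) ≡ true →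
           mem (vecK n a b) (toℕ i + toℕ j) ≡ true
  closed i j i∈ j∈ =
    ∈vecK (toℕ i + toℕ j) (memK-+ kunz (toℕ i) (toℕ j) (∈memK (toℕ i) i∈) (∈memK (toℕ j) j∈))

kunzStep : Bool → ℕ → ℕ
kunzStep true  _ = 0
kunzStep false a = suc a

-- The Kunz coordinate of a residue class is the number of its leading gaps.
kunzOf : ∀ n → Vec Bool (n * 3) → ℕ × ℕ
kunzOf zero    []              = 0 , 0
kunzOf (suc n) (_ ∷ y ∷ z ∷ v) = Product.map (kunzStep y) (kunzStep z) (kunzOf n v)

kunzOf-vecK : ∀ {n a b} → a ≤ n → b ≤ n → kunzOf n (vecK n a b) ≡ (a , b)
kunzOf-vecK {zero}  z≤n z≤n = refl
kunzOf-vecK {suc n} {a} {b} a≤n b≤n rewrite kunzOf-vecK {n} (pred-mono-≤ a≤n) (pred-mono-≤ b≤n) =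
  cong₂ _,_ (kunzStep-pred a) (kunzStep-pred b)
  where
  kunzStep-pred : ∀ a → kunzStep (a ≡ᵇ 0) (pred a) ≡ a
  kunzStep-pred zero    = refl
  kunzStep-pred (suc a) = refl

kunzOf-bounded : ∀ n (v : Vec Bool (n * 3)) → proj₁ (kunzOf n v) ≤ n × proj₂ (kunzOf n v) ≤ n
kunzOf-bounded zero    []              = z≤n , z≤n
kunzOf-bounded (suc n) (_ ∷ y ∷ z ∷ v) =
  kunzStep-≤ y (proj₁ (kunzOf-bounded n v)) , kunzStep-≤ z (proj₂ (kunzOf-bounded n v))
  where
  kunzStep-≤ : ∀ y {a} → a ≤ n → kunzStep y a ≤ suc n
  kunzStep-≤ true  _   = z≤n
  kunzStep-≤ false a≤n = s≤s a≤n

vecK-kunzOf : ∀ n (v : Vec Bool (n * 3)) →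
              mem v 0 ≡ true → (∀ i → mem v i ≡ true → mem v (3 + i) ≡ true) →
              v ≡ uncurry (vecK n) (kunzOf n v)
vecK-kunzOf zero    []              _  _  = refl
vecK-kunzOf (suc n) (x ∷ y ∷ z ∷ w) 0∈ +3 =
  cong₂ _∷_ 0∈ (cong₂ _∷_ (sym (kunzStep-≡ᵇ0 y)) (cong₂ _∷_ (sym (kunzStep-≡ᵇ0 z))
    (trans (vecK-kunzOf n w (+3 0 0∈) (λ i → +3 (3 + i)))
           (cong₂ (vecK n) (pred-kunzStep y (λ { refl → first-zero n w (+3 1 refl) }))
                           (pred-kunzStep z (λ { refl → second-zero n w (+3 2 refl) }))))))
  where
  a = proj₁ (kunzOf n w)
  b = proj₂ (kunzOf n w)
  kunzStep-≡ᵇ0 : ∀ y {c} → (kunzStep y c ≡ᵇ 0) ≡ y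
  kunzStep-≡ᵇ0 true  = refl
  kunzStep-≡ᵇ0 false = refl
  pred-kunzStep : ∀ y {c} → (y ≡ true → c ≡ 0) → c ≡ pred (kunzStep y c)
  pred-kunzStep true  c≡0 = c≡0 refl
  pred-kunzStep false _   = refl
  first-zero : ∀ n (w : Vec Bool (n * 3)) → mem w 1 ≡ true → proj₁ (kunzOf n w) ≡ 0
  first-zero zero    []                 _    = refl
  first-zero (suc n) (_ ∷ true ∷ _ ∷ _) refl = refl
  second-zero : ∀ n (w : Vec Bool (n * 3)) → mem w 2 ≡ true → proj₂ (kunzOf n w) ≡ 0
  second-zero zero    []                 _    = refl
  second-zero (suc n) (_ ∷ _ ∷ true ∷ _) refl = refl

module _ {n q} {v : Vec Bool (n * 3)} (ns : IsNSContaining 3 q v) where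

  private
    a = proj₁ (kunzOf n v)
    b = proj₂ (kunzOf n v)
    isNS = proj₁ ns

  isNS⇒vecK : v ≡ vecK n a b
  isNS⇒vecK = vecK-kunzOf n v (proj₁ isNS) (λ i → isNS-+ {v = v} isNS 3 i (proj₁ (proj₂ ns)))

  private
    mem≡memK : ∀ i → mem v i ≡ memK a b i
    mem≡memK i = trans (cong (λ w → mem w i) isNS⇒vecK)
                       (mem-vecK (proj₁ (kunzOf-bounded n v)) (proj₂ (kunzOf-bounded n v)) i)

    double∈ : ∀ i → memK a b i ≡ true → memK a b (i + i) ≡ true
    double∈ i i∈ = trans (sym (mem≡memK (i + i))) (isNS-+ {v = v} isNS i i v∋i v∋i)
      where v∋i = trans (mem≡memK i) i∈

  isNS⇒Kunz : Kunz (a , b)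
  isNS⇒Kunz =
    memK-2⁻ a b (2 * a)
      (subst (λ k → memK a b k ≡ true) (e₁ a) (double∈ (a * 3 + 1) (memK-1⁺ {a} b ≤-refl))) ,
    memK-1⁻ a b (suc (2 * b))
      (subst (λ k → memK a b k ≡ true) (e₂ b) (double∈ (b * 3 + 2) (memK-2⁺ {b} a ≤-refl)))
    where
    e₁ : ∀ a → (a * 3 + 1) + (a * 3 + 1) ≡ 2 * a * 3 + 2
    e₁ = solve-∀
    e₂ : ∀ b → (b * 3 + 2) + (b * 3 + 2) ≡ suc (2 * b) * 3 + 1
    e₂ = solve-∀

  isNS⇒Contains : Contains q (a , b)
  isNS⇒Contains = trans (sym (mem≡memK q)) (proj₂ (proj₂ ns))

vecK-isNS⇔ : ∀ {n a b q} → a ≤ n → b ≤ n →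
             IsNSContaining 3 q (vecK n a b) ⇔ (Contains q (a , b) × Kunz (a , b))
vecK-isNS⇔ {n} {a} {b} {q} a≤n b≤n = mk⇔
  (λ ns → subst (λ p → Contains q p × Kunz p) (kunzOf-vecK a≤n b≤n)
            (isNS⇒Contains {n} {q} {vecK n a b} ns , isNS⇒Kunz {n} {q} {vecK n a b} ns))
  (λ (q∈ , kunz) → vecK-isNS a≤n b≤n kunz q∈)

-- Symmetric and pseudo-symmetric semigroups

-- With Apéry elements w₁ = 3a+1 and w₂ = 3b+2: one of them is twice the other (SymK),
-- or twice the other minus 3 (PsymK).
SymK : Pred (ℕ × ℕ) 0ℓ
SymK (a , b) = b ≡ 2 * a ⊎ a ≡ suc (2 * b)

PsymK : Pred (ℕ × ℕ) 0ℓ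
PsymK (a , b) = suc b ≡ 2 * a ⊎ a ≡ 2 * b × 0 < b

symK? : Decidable SymK
symK? (a , b) = (b ≟ 2 * a) ⊎-dec (a ≟ suc (2 * b))

psymK? : Decidable PsymK
psymK? (a , b) = (suc b ≟ 2 * a) ⊎-dec ((a ≟ 2 * b) ×-dec (0 <? b))

SymK⇒Kunz : ∀ {p} → SymK p → Kunz p
SymK⇒Kunz {a , b} (inj₁ refl) = ≤-refl , ≤-trans (n≤2*n a) (≤-trans (n≤2*n (2 * a)) (n≤1+n _))
SymK⇒Kunz {a , b} (inj₂ refl) = ≤-trans (n≤2*n b) (≤-trans (n≤1+n _) (n≤2*n _)) , ≤-refl

PsymK⇒Kunz : ∀ {p} → PsymK p → Kunz p
PsymK⇒Kunz {a , b} (inj₁ 1+b≡2a) =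
  subst (b ≤_) 1+b≡2a (n≤1+n b) , ≤-trans (n≤2*n a) (subst (_≤ suc (2 * b)) 1+b≡2a (s≤s (n≤2*n b)))
PsymK⇒Kunz {a , b} (inj₂ (refl , _)) = ≤-trans (n≤2*n b) (n≤2*n _) , n≤1+n _

frobeniusEquation-≤ : ∀ {n a b} d → a ≤ n → b ≤ n → a ≤ b →
  (2 * genus (vecK n a b) ≡ d + frob1 (vecK n a b)) ≡ (2 * (a + b) ≡ d + b * 3)
frobeniusEquation-≤ d a≤n b≤n a≤b =
  cong₂ (λ g f → 2 * g ≡ d + f) (genus-vecK a≤n b≤n) (frob1-vecK-≤ a≤b b≤n)

frobeniusEquation-> : ∀ {n a b} d → suc a ≤ n → b ≤ n → b ≤ a →
  (2 * genus (vecK n (suc a) b) ≡ d + frob1 (vecK n (suc a) b)) ≡ (2 * (suc a + b) ≡ d + suc (suc (a * 3)))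
frobeniusEquation-> d a≤n b≤n b≤a =
  cong₂ (λ g f → 2 * g ≡ d + f) (genus-vecK a≤n b≤n) (frob1-vecK-> b≤a a≤n)

symK-≤ : ∀ {a b} → a ≤ b → 2 * (a + b) ≡ b * 3 ⇔ SymK (a , b)
symK-≤ {a} {b} a≤b = mk⇔
  (λ e → inj₁ (sym (Equivalence.to (2[a+b]≡d+3b⇔ a b 0) e)))
  λ { (inj₁ b≡2a) → Equivalence.from (2[a+b]≡d+3b⇔ a b 0) (sym b≡2a)
    ; (inj₂ refl) → contradiction a≤b (<⇒≱ (s≤s (n≤2*n b))) }

symK-> : ∀ {a b} → b ≤ a → 2 * (suc a + b) ≡ suc (suc (a * 3)) ⇔ SymK (suc a , b)
symK-> {a} {b} b≤a = mk⇔
  (λ e → inj₂ (cong suc (sym (Equivalence.to (2[1+a+b]≡d+3a+2⇔ a b 0) e))))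
  λ { (inj₁ refl) → contradiction b≤a (<⇒≱ (n≤2*n (suc a)))
    ; (inj₂ 1+a≡1+2b) → Equivalence.from (2[1+a+b]≡d+3a+2⇔ a b 0) (sym (suc-injective 1+a≡1+2b)) }

psymK-≤ : ∀ {a b} → a ≤ b → 2 * (a + b) ≡ suc (b * 3) ⇔ PsymK (a , b)
psymK-≤ {a} {b} a≤b = mk⇔
  (λ e → inj₁ (sym (Equivalence.to (2[a+b]≡d+3b⇔ a b 1) e)))
  λ { (inj₁ 1+b≡2a) → Equivalence.from (2[a+b]≡d+3b⇔ a b 1) (sym 1+b≡2a)
    ; (inj₂ (refl , 0<b)) → contradiction a≤b (<⇒≱ (n<2*n 0<b)) }

psymK-> : ∀ {a b} → b ≤ a → 2 * (suc a + b) ≡ suc (suc (suc (a * 3))) ⇔ PsymK (suc a , b)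
psymK-> {a} {b} b≤a = mk⇔
  (λ e → let 2b≡1+a = Equivalence.to (2[1+a+b]≡d+3a+2⇔ a b 1) e in inj₂ (sym 2b≡1+a , positive b 2b≡1+a))
  λ { (inj₁ 1+b≡2[1+a]) → contradiction (subst (suc b <_) (sym 1+b≡2[1+a]) 1+b<2[1+a]) (<-irrefl refl)
    ; (inj₂ (1+a≡2b , _)) → Equivalence.from (2[1+a+b]≡d+3a+2⇔ a b 1) (sym 1+a≡2b) }
  where
  positive : ∀ b → 2 * b ≡ suc a → 0 < b
  positive (suc b) _ = s≤s z≤n
  1+b<2[1+a] : suc b < 2 * suc a
  1+b<2[1+a] = ≤-<-trans (s≤s b≤a) (n<2*n (s≤s z≤n))

symmetric⇔SymK : ∀ {n a b} → a ≤ n → b ≤ n → IsSymmetric (vecK n a b) ⇔ SymK (a , b)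
symmetric⇔SymK {a = a} {b} a≤n b≤n with ≤-<-connex a b
... | inj₁ a≤b = subst (_⇔ SymK (a , b)) (sym (frobeniusEquation-≤ 0 a≤n b≤n a≤b)) (symK-≤ a≤b)
symmetric⇔SymK {a = suc a} {b} a≤n b≤n | inj₂ (s≤s b≤a) =
  subst (_⇔ SymK (suc a , b)) (sym (frobeniusEquation-> 0 a≤n b≤n b≤a)) (symK-> b≤a)

pseudoSymmetric⇔PsymK : ∀ {n a b} → a ≤ n → b ≤ n → IsPseudoSymmetric (vecK n a b) ⇔ PsymK (a , b)
pseudoSymmetric⇔PsymK {a = a} {b} a≤n b≤n with ≤-<-connex a b
... | inj₁ a≤b = subst (_⇔ PsymK (a , b)) (sym (frobeniusEquation-≤ 1 a≤n b≤n a≤b)) (psymK-≤ a≤b)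
pseudoSymmetric⇔PsymK {a = suc a} {b} a≤n b≤n | inj₂ (s≤s b≤a) =
  subst (_⇔ PsymK (suc a , b)) (sym (frobeniusEquation-> 1 a≤n b≤n b≤a)) (psymK-> b≤a)

isNS×⇔ : ∀ {n a b q} {R : Set} {P : Pred (ℕ × ℕ) 0ℓ} →
         (P (a , b) → Kunz (a , b)) → a ≤ n → b ≤ n → R ⇔ P (a , b) →
         (IsNSContaining 3 q (vecK n a b) × R) ⇔ (Contains q (a , b) × P (a , b))
isNS×⇔ P⇒Kunz a≤n b≤n R⇔P = mk⇔
  (λ (ns , r) → proj₁ (Equivalence.to (vecK-isNS⇔ a≤n b≤n) ns) , Equivalence.to R⇔P r)
  (λ (q∈ , p) → Equivalence.from (vecK-isNS⇔ a≤n b≤n) (q∈ , P⇒Kunz p) , Equivalence.from R⇔P p)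

-- Counting semigroups by their Kunz coordinates

module Counting
  (F : ℕ → ∀ {B} → Pred (Vec Bool B) 0ℓ) (F? : ∀ q {B} → Decidable (F q {B}))
  (F⇒isNS : ∀ {q B} {v : Vec Bool B} → F q v → IsNSContaining 3 q v)
  {P : Pred (ℕ × ℕ) 0ℓ} (P? : Decidable P) (P⇒Kunz : ∀ {p} → P p → Kunz p)
  (F⇔P : ∀ {q n a b} → a ≤ n → b ≤ n → F q (vecK n a b) ⇔ (Contains q (a , b) × P (a , b)))
  where

  open ≡-Reasoning

  count : ℕ → ℕ
  count q = length (filter (F? q) (allVecs (3 * q)))

  pairCount : ℕ → ℕ → ℕ
  pairCount K q = length (filter (contains? q ∩? P?) (box K))

  private
    bounded : ∀ {q p} → ¬ 3 ∣ q → (Contains q ∩ P) p → proj₁ p ≤ q × proj₂ p ≤ q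
    bounded 3∤q (q∈ , Pp) = kunz-bounded 3∤q (P⇒Kunz Pp) q∈

  count≡pairCount : ∀ {q K} → ¬ 3 ∣ q → q < K → count q ≡ pairCount K q
  count≡pairCount {q} {K} 3∤q q<K = begin
    count q
      ≡⟨ cong (λ B → length (filter (F? q {B}) (allVecs B))) (*-comm 3 q) ⟩
    length (filter (F? q) (allVecs (q * 3)))
      ≡⟨ length-∼set vecs-unique image-unique (mk⇔ to from) ⟩
    length (map (uncurry (vecK q)) pairs)
      ≡⟨ length-map (uncurry (vecK q)) pairs ⟩
    pairCount K q ∎
    where
    pairs : List (ℕ × ℕ)
    pairs = filter (contains? q ∩? P?) (box K)
    vecs-unique : Unique (filter (F? q) (allVecs (q * 3)))
    vecs-unique = Unique.filter⁺ (F? q) {allVecs (q * 3)} (allVecs-unique (q * 3))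
    image-unique : Unique (map (uncurry (vecK q)) pairs)
    image-unique = Unique-map⁺-retraction (kunzOf q)
      (All.tabulate λ p∈ → uncurry kunzOf-vecK
                             (bounded 3∤q (proj₂ (∈-filter⁻ (contains? q ∩? P?) {xs = box K} p∈))))
      (Unique.filter⁺ (contains? q ∩? P?) {box K} (box-unique K))
    to : ∀ {v} → v ∈ filter (F? q) (allVecs (q * 3)) → v ∈ map (uncurry (vecK q)) pairs
    to {v} v∈ = subst (_∈ map (uncurry (vecK q)) pairs) (sym v≡vecK) (∈-map⁺ (uncurry (vecK q)) p∈)
      where
      Fv = proj₂ (∈-filter⁻ (F? q) {xs = allVecs (q * 3)} v∈)
      v≡vecK = isNS⇒vecK {q} {q} {v} (F⇒isNS Fv)
      a≤q = proj₁ (kunzOf-bounded q v)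
      b≤q = proj₂ (kunzOf-bounded q v)
      p∈ : kunzOf q v ∈ pairs
      p∈ = ∈-filter⁺ (contains? q ∩? P?) (∈-box (≤-<-trans a≤q q<K) (≤-<-trans b≤q q<K))
             (Equivalence.to (F⇔P a≤q b≤q) (subst (F q) v≡vecK Fv))
    from : ∀ {v} → v ∈ map (uncurry (vecK q)) pairs → v ∈ filter (F? q) (allVecs (q * 3))
    from {v} v∈ with ∈-map⁻ (uncurry (vecK q)) v∈
    ... | p , p∈ , refl = ∈-filter⁺ (F? q) (∈-allVecs v) (Equivalence.from (F⇔P a≤q b≤q) Pp)
      where
      Pp = proj₂ (∈-filter⁻ (contains? q ∩? P?) {xs = box K} p∈)
      a≤q = proj₁ (bounded 3∤q Pp)
      b≤q = proj₂ (bounded 3∤q Pp)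

  pairCount-step : ∀ {K q} (ι : ℕ → ℕ × ℕ) → (∀ {c d} → ι c ≡ ι d → c ≡ d) →
    (∀ {p} → Contains (3 + q) p → ¬ Contains q p → ∃ λ c → p ≡ ι c) →
    (∀ c → Contains (3 + q) (ι c) × ¬ Contains q (ι c)) →
    ¬ 3 ∣ 3 + q → 3 + q < K →
    (L : List ℕ) → Unique L → (∀ {c} → P (ι c) ⇔ c ∈ L) →
    pairCount K (3 + q) ≡ pairCount K q + length L
  pairCount-step {K} {q} ι ι-injective new⇒ι ι-new 3∤q′ q′<K L L! P⇔L = begin
    pairCount K (3 + q)
      ≡⟨ length-filter-split (contains? (3 + q) ∩? P?) (contains? q) (box K) ⟩
    length (filter old? (box K)) + length (filter new? (box K))
      ≡⟨ cong₂ _+_ (cong length (filter-≐ old? (contains? q ∩? P?) old≐ (box K)))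
                   (trans (length-∼set (Unique.filter⁺ new? {box K} (box-unique K)) (Unique.map⁺ ι-injective L!)
                                       (mk⇔ to from))
                          (length-map ι L)) ⟩
    pairCount K q + length L ∎
    where
    old? : Decidable ((Contains (3 + q) ∩ P) ∩ Contains q)
    old? = (contains? (3 + q) ∩? P?) ∩? contains? q
    new? : Decidable ((Contains (3 + q) ∩ P) ∩ ∁ (Contains q))
    new? = (contains? (3 + q) ∩? P?) ∩? ∁? (contains? q)
    old≐ : ((Contains (3 + q) ∩ P) ∩ Contains q) ≐ (Contains q ∩ P)
    old≐ = (λ ((_ , Pp) , q∈) → q∈ , Pp) ,
           λ {p} (q∈ , Pp) → (memK-+3 (proj₁ p) (proj₂ p) q q∈ , Pp) , q∈
    to : ∀ {p} → p ∈ filter new? (box K) → p ∈ map ι L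
    to p∈ with ∈-filter⁻ new? {xs = box K} p∈
    ... | _ , (q′∈ , Pp) , q∉ with new⇒ι q′∈ q∉
    ... | c , refl = ∈-map⁺ ι (Equivalence.to P⇔L Pp)
    from : ∀ {p} → p ∈ map ι L → p ∈ filter new? (box K)
    from p∈ with ∈-map⁻ ι p∈
    ... | c , c∈L , refl =
      ∈-filter⁺ new? (∈-box (≤-<-trans a≤q′ q′<K) (≤-<-trans b≤q′ q′<K)) ((q′∈ , Pιc) , q∉)
      where
      Pιc = Equivalence.from P⇔L c∈L
      q′∈ = proj₁ (ι-new c)
      q∉  = proj₂ (ι-new c)
      a≤q′ = proj₁ (bounded 3∤q′ (q′∈ , Pιc))
      b≤q′ = proj₂ (bounded 3∤q′ (q′∈ , Pιc))

  count-step₁ : ∀ T → 0 < T → (L : List ℕ) → Unique L → (∀ {c} → P (T , c) ⇔ c ∈ L) →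
                count (T * 3 + 1) ≡ count (T * 3 + 1 ∸ 3) + length L
  count-step₁ zero    ()
  count-step₁ (suc t) _ L L! P⇔L = begin
    count (3 + q)
      ≡⟨ count≡pairCount (3∤3t+1 (suc t)) ≤-refl ⟩
    pairCount K (3 + q)
      ≡⟨ pairCount-step (suc t ,_) (cong proj₂) new⇒row row-new (3∤3t+1 (suc t)) ≤-refl L L! P⇔L ⟩
    pairCount K q + length L
      ≡⟨ cong (_+ length L) (count≡pairCount (3∤3t+1 t) (m≤n+m (suc q) 3)) ⟨
    count q + length L ∎
    where
    q = t * 3 + 1
    K = suc (3 + q)
    new⇒row : ∀ {p} → Contains (3 + q) p → ¬ Contains q p → ∃ λ c → p ≡ (suc t , c)
    new⇒row {a , b} q′∈ q∉ =
      b , cong (_, b) (≤-antisym (memK-1⁻ a b (suc t) q′∈) (≰⇒> (q∉ ∘ memK-1⁺ b)))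
    row-new : ∀ c → Contains (3 + q) (suc t , c) × ¬ Contains q (suc t , c)
    row-new c = memK-1⁺ {suc t} c ≤-refl , 1+n≰n ∘ memK-1⁻ (suc t) c t

  count-step₂ : ∀ T → 0 < T → (L : List ℕ) → Unique L → (∀ {c} → P (c , T) ⇔ c ∈ L) →
                count (T * 3 + 2) ≡ count (T * 3 + 2 ∸ 3) + length L
  count-step₂ zero    ()
  count-step₂ (suc t) _ L L! P⇔L = begin
    count (3 + q)
      ≡⟨ count≡pairCount (3∤3t+2 (suc t)) ≤-refl ⟩
    pairCount K (3 + q)
      ≡⟨ pairCount-step (_, suc t) (cong proj₁) new⇒row row-new (3∤3t+2 (suc t)) ≤-refl L L! P⇔L ⟩
    pairCount K q + length L
      ≡⟨ cong (_+ length L) (count≡pairCount (3∤3t+2 t) (m≤n+m (suc q) 3)) ⟨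
    count q + length L ∎
    where
    q = t * 3 + 2
    K = suc (3 + q)
    new⇒row : ∀ {p} → Contains (3 + q) p → ¬ Contains q p → ∃ λ c → p ≡ (c , suc t)
    new⇒row {a , b} q′∈ q∉ =
      a , cong (a ,_) (≤-antisym (memK-2⁻ a b (suc t) q′∈) (≰⇒> (q∉ ∘ memK-2⁺ a)))
    row-new : ∀ c → Contains (3 + q) (c , suc t) × ¬ Contains q (c , suc t)
    row-new c = memK-2⁺ {suc t} c ≤-refl , 1+n≰n ∘ memK-2⁻ c (suc t) t

module NCount = Counting (λ q → IsNSContaining 3 q) (λ q → isNSContaining? 3 q) (λ ns → ns)
  kunz? (λ kunz → kunz) vecK-isNS⇔

module SymCount = Counting (λ q v → IsNSContaining 3 q v × IsSymmetric v)
  (λ q v → isNSContaining? 3 q v ×-dec (2 * genus v ≟ frob1 v)) proj₁ symK? SymK⇒Kunz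
  (λ a≤n b≤n → isNS×⇔ {P = SymK} SymK⇒Kunz a≤n b≤n (symmetric⇔SymK a≤n b≤n))

module PsymCount = Counting (λ q v → IsNSContaining 3 q v × IsPseudoSymmetric v)
  (λ q v → isNSContaining? 3 q v ×-dec (2 * genus v ≟ suc (frob1 v))) proj₁ psymK? PsymK⇒Kunz
  (λ a≤n b≤n → isNS×⇔ {P = PsymK} PsymK⇒Kunz a≤n b≤n (pseudoSymmetric⇔PsymK a≤n b≤n))

-- The rows of the Kunz polygon

row⇔range : ∀ {L U : Set} {lo len c} → L ⇔ (lo ≤ c) → U ⇔ (c < lo + len) →
            (L × U) ⇔ (c ∈ range lo len)
row⇔range L⇔ U⇔ = ∈-range⇔ ⇔-∘ (L⇔ ×-⇔ U⇔)

swap⇔ : ∀ {A B : Set} → (A × B) ⇔ (B × A)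
swap⇔ = mk⇔ Product.swap Product.swap

kunzRow-6k+1 : ∀ M {c} → Kunz (2 * M , c) ⇔ c ∈ range M (M * 3 + 1)
kunzRow-6k+1 M = row⇔range 2m≤1+2n⇔ (≤⇔< (e M)) ⇔-∘ swap⇔
  where e : ∀ M → M + (M * 3 + 1) ≡ suc (2 * (2 * M))
        e = solve-∀

symRow-6k+1 : ∀ M {c} → SymK (2 * M , c) ⇔ c ∈ 2 * (2 * M) ∷ []
symRow-6k+1 M {c} = mk⇔
  (λ { (inj₁ refl) → here refl ; (inj₂ 2M≡1+2c) → contradiction 2M≡1+2c (even≢odd M c) })
  (λ { (here refl) → inj₁ refl })

psymRow-6k+1 : ∀ m {c} → PsymK (2 * suc m , c) ⇔ c ∈ suc m ∷ pred (2 * (2 * suc m)) ∷ []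
psymRow-6k+1 m {c} = mk⇔
  (λ { (inj₁ 1+c≡4M) → there (here (cong pred 1+c≡4M))
     ; (inj₂ (2M≡2c , _)) → here (sym (*-cancelˡ-≡ _ _ 2 2M≡2c)) })
  (λ { (here refl) → inj₂ (refl , s≤s z≤n) ; (there (here refl)) → inj₁ refl })

kunzRow-6k+4 : ∀ m {c} → Kunz (suc (2 * m) , c) ⇔ c ∈ range m (m * 3 + 2 + 1)
kunzRow-6k+4 m = row⇔range 1+2m≤1+2n⇔ (≤⇔< (e m)) ⇔-∘ swap⇔
  where e : ∀ m → m + (m * 3 + 2 + 1) ≡ suc (2 * suc (2 * m))
        e = solve-∀

symRow-6k+4 : ∀ m {c} → SymK (suc (2 * m) , c) ⇔ c ∈ m ∷ 2 * suc (2 * m) ∷ []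
symRow-6k+4 m {c} = mk⇔
  (λ { (inj₁ refl) → there (here refl)
     ; (inj₂ 1+2m≡1+2c) → here (sym (*-cancelˡ-≡ _ _ 2 (suc-injective 1+2m≡1+2c))) })
  (λ { (here refl) → inj₂ refl ; (there (here refl)) → inj₁ refl })

psymRow-6k+4 : ∀ m {c} → PsymK (suc (2 * m) , c) ⇔ c ∈ pred (2 * suc (2 * m)) ∷ []
psymRow-6k+4 m {c} = mk⇔
  (λ { (inj₁ 1+c≡2T) → here (cong pred 1+c≡2T)
     ; (inj₂ (1+2m≡2c , _)) → contradiction (sym 1+2m≡2c) (even≢odd c m) })
  (λ { (here refl) → inj₁ refl })

kunzRow-6k+2 : ∀ M {c} → Kunz (c , 2 * M) ⇔ c ∈ range M (M * 3 + 1 + 1)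
kunzRow-6k+2 M = row⇔range 2m≤2n⇔ (≤⇔< (e M))
  where e : ∀ M → M + (M * 3 + 1 + 1) ≡ suc (suc (2 * (2 * M)))
        e = solve-∀

symRow-6k+2 : ∀ M {c} → SymK (c , 2 * M) ⇔ c ∈ M ∷ suc (2 * (2 * M)) ∷ []
symRow-6k+2 M {c} = mk⇔
  (λ { (inj₁ 2M≡2c) → here (sym (*-cancelˡ-≡ _ _ 2 2M≡2c)) ; (inj₂ refl) → there (here refl) })
  (λ { (here refl) → inj₁ refl ; (there (here refl)) → inj₂ refl })

psymRow-6k+2 : ∀ m {c} → PsymK (c , 2 * suc m) ⇔ c ∈ 2 * (2 * suc m) ∷ []
psymRow-6k+2 m {c} = mk⇔
  (λ { (inj₁ 1+2M≡2c) → contradiction (sym 1+2M≡2c) (even≢odd c (suc m))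
     ; (inj₂ (refl , _)) → here refl })
  (λ { (here refl) → inj₂ (refl , s≤s z≤n) })

kunzRow-6k+5 : ∀ m {c} → Kunz (c , suc (2 * m)) ⇔ c ∈ range (suc m) (m * 3 + 2 + 1)
kunzRow-6k+5 m = row⇔range 1+2m≤2n⇔ (≤⇔< (e m))
  where e : ∀ m → suc m + (m * 3 + 2 + 1) ≡ suc (suc (2 * suc (2 * m)))
        e = solve-∀

symRow-6k+5 : ∀ m {c} → SymK (c , suc (2 * m)) ⇔ c ∈ suc (2 * suc (2 * m)) ∷ []
symRow-6k+5 m {c} = mk⇔
  (λ { (inj₁ 1+2m≡2c) → contradiction (sym 1+2m≡2c) (even≢odd c m) ; (inj₂ refl) → here refl })
  (λ { (here refl) → inj₂ refl })

psymRow-6k+5 : ∀ m {c} → PsymK (c , suc (2 * m)) ⇔ c ∈ suc m ∷ 2 * suc (2 * m) ∷ []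
psymRow-6k+5 m {c} = mk⇔
  (λ { (inj₁ 2+2m≡2c) → here (*-cancelˡ-≡ _ _ 2 (trans (sym 2+2m≡2c) (sym (*-suc 2 m))))
     ; (inj₂ (refl , _)) → there (here refl) })
  (λ { (here refl) → inj₁ (sym (*-suc 2 m)) ; (there (here refl)) → inj₂ (refl , s≤s z≤n) })

Recurrences : ℕ → Set
Recurrences q = (N 3 q ≡ N 3 (q ∸ 3) + q / 2 + 1) ×
                (Sym 3 q ≡ Sym 3 (q ∸ 3) + (if q % 2 ≡ᵇ 0 then 2 else 1)) ×
                (Psym 3 q ≡ Psym 3 (q ∸ 3) + (if q % 2 ≡ᵇ 0 then 1 else 2))

recurrences-odd : ∀ {q} k → q ≡ suc (k * 2) → N 3 q ≡ N 3 (q ∸ 3) + (k + 1) →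
                  Sym 3 q ≡ Sym 3 (q ∸ 3) + 1 → Psym 3 q ≡ Psym 3 (q ∸ 3) + 2 → Recurrences q
recurrences-odd k refl N-step Sym-step Psym-step =
  trans N-step (trans (cong (λ h → N 3 q′ + (h + 1)) (sym half)) (sym (+-assoc (N 3 q′) _ 1))) ,
  trans Sym-step (cong (λ r → Sym 3 q′ + (if r ≡ᵇ 0 then 2 else 1)) (sym rem)) ,
  trans Psym-step (cong (λ r → Psym 3 q′ + (if r ≡ᵇ 0 then 1 else 2)) (sym rem))
  where
  q′ = suc (k * 2) ∸ 3
  half : suc (k * 2) / 2 ≡ k
  half = trans (+-distrib-/-∣ʳ 1 {d = 2} (n∣m*n k)) (m*n/n≡m k 2)
  rem : suc (k * 2) % 2 ≡ 1
  rem = [m+kn]%n≡m%n 1 k 2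

recurrences-even : ∀ {q} k → q ≡ k * 2 → N 3 q ≡ N 3 (q ∸ 3) + (k + 1) →
                   Sym 3 q ≡ Sym 3 (q ∸ 3) + 2 → Psym 3 q ≡ Psym 3 (q ∸ 3) + 1 → Recurrences q
recurrences-even k refl N-step Sym-step Psym-step =
  trans N-step (trans (cong (λ h → N 3 q′ + (h + 1)) (sym (m*n/n≡m k 2))) (sym (+-assoc (N 3 q′) _ 1))) ,
  trans Sym-step (cong (λ r → Sym 3 q′ + (if r ≡ᵇ 0 then 2 else 1)) (sym (m*n%n≡0 k 2))) ,
  trans Psym-step (cong (λ r → Psym 3 q′ + (if r ≡ᵇ 0 then 1 else 2)) (sym (m*n%n≡0 k 2)))
  where q′ = k * 2 ∸ 3

recurrences-6k+1 : ∀ m → Recurrences (2 * suc m * 3 + 1)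
recurrences-6k+1 m = recurrences-odd (M * 3) (e m)
  (trans (NCount.count-step₁ T (s≤s z≤n) (range M (M * 3 + 1)) (range-unique M _) (kunzRow-6k+1 M))
         (cong (N 3 (T * 3 + 1 ∸ 3) +_) (length-range M _)))
  (SymCount.count-step₁ T (s≤s z≤n) _ unique₁ (symRow-6k+1 M))
  (PsymCount.count-step₁ T (s≤s z≤n) _ (unique₂ (<⇒≢ (<-by (3 * m + 1) (cong pred (e′ m)))))
                         (psymRow-6k+1 m))
  where
  M = suc m
  T = 2 * M
  e : ∀ m → 2 * suc m * 3 + 1 ≡ suc (suc m * 3 * 2)
  e = solve-∀
  e′ : ∀ m → 2 * (2 * suc m) ≡ suc (suc (suc m + (3 * m + 1)))
  e′ = solve-∀

recurrences-6k+4 : ∀ m → Recurrences (suc (2 * m) * 3 + 1)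
recurrences-6k+4 m = recurrences-even (m * 3 + 2) (e m)
  (trans (NCount.count-step₁ T (s≤s z≤n) (range m (m * 3 + 2 + 1)) (range-unique m _) (kunzRow-6k+4 m))
         (cong (N 3 (T * 3 + 1 ∸ 3) +_) (length-range m _)))
  (SymCount.count-step₁ T (s≤s z≤n) _ (unique₂ (<⇒≢ (<-by (3 * m + 1) (e′ m)))) (symRow-6k+4 m))
  (PsymCount.count-step₁ T (s≤s z≤n) _ unique₁ (psymRow-6k+4 m))
  where
  T = suc (2 * m)
  e : ∀ m → suc (2 * m) * 3 + 1 ≡ (m * 3 + 2) * 2
  e = solve-∀
  e′ : ∀ m → 2 * suc (2 * m) ≡ suc (m + (3 * m + 1))
  e′ = solve-∀

recurrences-6k+2 : ∀ m → Recurrences (2 * suc m * 3 + 2)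
recurrences-6k+2 m = recurrences-even (M * 3 + 1) (e m)
  (trans (NCount.count-step₂ T (s≤s z≤n) (range M (M * 3 + 1 + 1)) (range-unique M _) (kunzRow-6k+2 M))
         (cong (N 3 (T * 3 + 2 ∸ 3) +_) (length-range M _)))
  (SymCount.count-step₂ T (s≤s z≤n) _ (unique₂ (<⇒≢ (s≤s (≤-trans (n≤2*n M) (n≤2*n T)))))
                        (symRow-6k+2 M))
  (PsymCount.count-step₂ T (s≤s z≤n) _ unique₁ (psymRow-6k+2 m))
  where
  M = suc m
  T = 2 * M
  e : ∀ m → 2 * suc m * 3 + 2 ≡ (suc m * 3 + 1) * 2
  e = solve-∀

recurrences-6k+5 : ∀ m → Recurrences (suc (2 * m) * 3 + 2)
recurrences-6k+5 m = recurrences-odd (m * 3 + 2) (e m)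
  (trans (NCount.count-step₂ T (s≤s z≤n) (range (suc m) (m * 3 + 2 + 1)) (range-unique (suc m) _)
                             (kunzRow-6k+5 m))
         (cong (N 3 (T * 3 + 2 ∸ 3) +_) (length-range (suc m) _)))
  (SymCount.count-step₂ T (s≤s z≤n) _ unique₁ (symRow-6k+5 m))
  (PsymCount.count-step₂ T (s≤s z≤n) _ (unique₂ (<⇒≢ (<-by (3 * m) (e′ m)))) (psymRow-6k+5 m))
  where
  T = suc (2 * m)
  e : ∀ m → suc (2 * m) * 3 + 2 ≡ suc ((m * 3 + 2) * 2)
  e = solve-∀
  e′ : ∀ m → 2 * suc (2 * m) ≡ suc (suc m + 3 * m)
  e′ = solve-∀

data Shape : ℕ → Set where
  6k+1 : ∀ m → Shape (2 * suc m * 3 + 1)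
  6k+4 : ∀ m → Shape (suc (2 * m) * 3 + 1)
  6k+2 : ∀ m → Shape (2 * suc m * 3 + 2)
  6k+5 : ∀ m → Shape (suc (2 * m) * 3 + 2)

shape : ∀ q → 3 < q → ¬ 3 ∣ q → Shape q
shape q 3<q 3∤q with mod3 q
... | 0mod3 t = contradiction (n∣m*n t) 3∤q
... | 1mod3 t with parityView t
...   | even zero    = contradiction (s≤s z≤n) (<⇒≱ 3<q)
...   | even (suc m) = 6k+1 m
...   | odd m        = 6k+4 m
shape q 3<q 3∤q | 2mod3 t with parityView t
...   | even zero    = contradiction (s≤s (s≤s z≤n)) (<⇒≱ 3<q)
...   | even (suc m) = 6k+2 m
...   | odd m        = 6k+5 m

recurrences-shape : ∀ {q} → Shape q → Recurrences q
recurrences-shape (6k+1 m) = recurrences-6k+1 m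
recurrences-shape (6k+4 m) = recurrences-6k+4 m
recurrences-shape (6k+2 m) = recurrences-6k+2 m
recurrences-shape (6k+5 m) = recurrences-6k+5 m

recurrences : ∀ {q} → 3 < q → Coprime 3 q → Recurrences q
recurrences {q} 3<q 3⊥q = recurrences-shape (shape q 3<q 3∤q)
  where
  3∤q : ¬ 3 ∣ q
  3∤q 3∣q with 3⊥q (∣-refl , 3∣q)
  ... | ()

mainTheorem11 :
    ((q : ℕ) → 3 < q → Coprime 3 q → N 3 q ≡ N 3 (q ∸ 3) + q / 2 + 1) ×
    ((q : ℕ) → 4 ≤ q → Coprime 3 q →
      (Sym 3 q ≡ Sym 3 (q ∸ 3) + (if q % 2 ≡ᵇ 0 then 2 else 1)) ×
      (Psym 3 q ≡ Psym 3 (q ∸ 3) + (if q % 2 ≡ᵇ 0 then 1 else 2)))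
mainTheorem11 =
  (λ q 3<q 3⊥q → proj₁ (recurrences 3<q 3⊥q)) ,
  (λ q 4≤q 3⊥q → proj₂ (recurrences 4≤q 3⊥q))
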